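{- Let $A$ be a Glivenko residuated lattice. Then $A/Ds(A)$ is an MV-algebra iff $A$ satisfies the equation $(\neg a\rightarrow\neg b)\rightarrow\neg b=(\neg b\rightarrow\neg a)\rightarrow\neg a$ for all $a,b\in A$.
   Context: A (commutative) residuated lattice is an algebra $(A,\vee,\wedge,\odot,\rightarrow,0,1)$ such that $(A,\vee,\wedge,0,1)$ is a bounded lattice, $(A,\odot,1)$ is a commutative monoid, and for all $a,b,c\in A$: $a\le b\rightarrow c$ iff $a\odot b\le c$. Write $\neg a=a\rightarrow 0$, $a\leftrightarrow b=(a\rightarrow b)\wedge(b\rightarrow a)$. $A$ is Glivenko iff $\neg\neg(\neg\neg a\rightarrow a)=1$ for all $a$. $Ds(A)=\{a\in A\mid\neg a=0\}$ is a filter (nonempty, closed under $\odot$, upward closed), and $A/Ds(A)$ is the quotient residuated lattice by the congruence $a\equiv b$ iff $a\leftrightarrow b\in Ds(A)$. A residuated lattice is an MV-algebra (in residuated-lattice form) iff it is an involutive BL-algebra, i.e. it satisfies $(x\rightarrow y)\vee(y\rightarrow x)=1$, $x\wedge y=x\odot(x\rightarrow y)$ and $\neg\neg x=x$ for all $x,y$. -}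

module Defs where

open import Level using (0ℓ)
open import Data.Product using (_×_)
open import Relation.Binary.PropositionalEquality using (_≡_)
open import Algebra.Core using (Op₂)
import Algebra.Structures as AS
import Algebra.Lattice.Structures as LS
open import Function.Bundles using (_⇔_)

record ResiduatedLattice : Set₁ where
  infixr 5 _⇒_
  infixl 7 _⊙_
  infixl 6 _∧_
  infixl 5 _∨_
  field
    Carrier : Set
    _∨_ _∧_ _⊙_ _⇒_ : Op₂ Carrier
    𝟘 𝟙 : Carrier

  _≤_ : Carrier → Carrier → Set
  a ≤ b = a ∧ b ≡ a

  field
    isLattice : LS.IsLattice {A = Carrier} _≡_ _∨_ _∧_
    𝟘-least   : ∀ a → 𝟘 ≤ a
    𝟙-greatest : ∀ a → a ≤ 𝟙
    ⊙-isCommutativeMonoid : AS.IsCommutativeMonoid {A = Carrier} _≡_ _⊙_ 𝟙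
    residuation : ∀ a b c → (a ≤ (b ⇒ c)) ⇔ ((a ⊙ b) ≤ c)

  ¬_ : Carrier → Carrier
  ¬ a = a ⇒ 𝟘

  _⇔ᵣ_ : Carrier → Carrier → Carrier
  a ⇔ᵣ b = (a ⇒ b) ∧ (b ⇒ a)

  IsGlivenko : Set
  IsGlivenko = ∀ a → ¬ (¬ ((¬ (¬ a)) ⇒ a)) ≡ 𝟙

  Ds : Carrier → Set
  Ds a = ¬ a ≡ 𝟘

  -- the congruence induced by Ds(A): a ~ b iff a ↔ b ∈ Ds(A).
  -- Equality in the quotient A/Ds(A) of the classes [a], [b] is exactly a ~ b.
  _~_ : Carrier → Carrier → Set
  a ~ b = Ds (a ⇔ᵣ b)

  -- A/Ds(A) is an MV-algebra (involutive BL-algebra): the defining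
  -- equations hold in the quotient, i.e. for representatives up to _~_.
  -- (Operations of A/Ds(A) are [a] op [b] = [a op b], and [1] is its top.)
  QuotientIsMV : Set
  QuotientIsMV =
      (∀ x y → ((x ⇒ y) ∨ (y ⇒ x)) ~ 𝟙)
    × (∀ x y → (x ∧ y) ~ (x ⊙ (x ⇒ y)))
    × (∀ x → (¬ (¬ x)) ~ x)

  SatisfiesEq : Set
  SatisfiesEq = ∀ a b → ((¬ a) ⇒ (¬ b)) ⇒ (¬ b) ≡ ((¬ b) ⇒ (¬ a)) ⇒ (¬ a)

module Submission where

-- The proof works with negations instead of the quotient.  In any residuated
-- lattice a ~ b (i.e. a ↔ b ∈ Ds(A)) implies ¬a = ¬b, and in a Glivenko one
-- the converse holds as well, because there ¬¬(p → q) = p → ¬¬q.  So every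
-- equation of A/Ds(A) becomes an equation between negations in A.
--
-- Divisibility in the quotient gives the
-- equation directly.  Conversely the equation says that on regular elements
-- (u → v) → v is symmetric, hence the least regular upper bound of u and v;
-- from this divisibility follows by one computation, prelinearity from the
-- inequality (p → q) ≤ q for p = ¬¬x → ¬¬y, q = ¬¬y → ¬¬x, and involution
-- from ¬¬¬x = ¬x.

open import Level using (0ℓ)
open import Data.Product using (_,_)
open import Function.Bundles using (_⇔_; mk⇔; Equivalence)
open import Relation.Binary.PropositionalEquality
open import Relation.Binary.Bundles using (Poset)
open import Algebra.Lattice.Bundles using (Lattice)
import Algebra.Lattice.Properties.Lattice as LatticeProperties
import Relation.Binary.Lattice.Bundles as OrderLattice
import Relation.Binary.Reasoning.PartialOrder as PosetReasoning
import Algebra.Structures as AS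

open import Defs

module ResiduatedLatticeTheory (A : ResiduatedLattice) where
  open ResiduatedLattice A hiding (_≤_)

  infix 4 _≤_
  _≤_ : Carrier → Carrier → Set
  _≤_ = ResiduatedLattice._≤_ A

  open AS.IsCommutativeMonoid ⊙-isCommutativeMonoid
    using (identityˡ; identityʳ) renaming (assoc to ⊙-assoc; comm to ⊙-comm)

  -- The library's order of the lattice reads a = a ∧ b; the basic order
  -- properties are imported from there.
  lattice : Lattice 0ℓ 0ℓ
  lattice = record { isLattice = isLattice }

  private
    module Order = OrderLattice.Lattice
      (LatticeProperties.∨-∧-orderTheoreticLattice lattice)

  ≤-refl : ∀ {a} → a ≤ a
  ≤-refl = sym Order.refl

  ≤-reflexive : ∀ {a b} → a ≡ b → a ≤ b
  ≤-reflexive refl = ≤-refl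

  ≤-trans : ∀ {a b c} → a ≤ b → b ≤ c → a ≤ c
  ≤-trans p q = sym (Order.trans (sym p) (sym q))

  ≤-antisym : ∀ {a b} → a ≤ b → b ≤ a → a ≡ b
  ≤-antisym p q = Order.antisym (sym p) (sym q)

  x∧y≤x : ∀ a b → a ∧ b ≤ a
  x∧y≤x a b = sym (Order.x∧y≤x a b)

  x∧y≤y : ∀ a b → a ∧ b ≤ b
  x∧y≤y a b = sym (Order.x∧y≤y a b)

  ∧-greatest : ∀ {a b c} → a ≤ b → a ≤ c → a ≤ b ∧ c
  ∧-greatest p q = sym (Order.∧-greatest (sym p) (sym q))

  x≤x∨y : ∀ a b → a ≤ a ∨ b
  x≤x∨y a b = sym (Order.x≤x∨y a b)

  y≤x∨y : ∀ a b → b ≤ a ∨ b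
  y≤x∨y a b = sym (Order.y≤x∨y a b)

  ≤-poset : Poset 0ℓ 0ℓ 0ℓ
  ≤-poset = record
    { _≈_ = _≡_
    ; _≤_ = _≤_
    ; isPartialOrder = record
      { isPreorder = record
        { isEquivalence = isEquivalence
        ; reflexive = ≤-reflexive
        ; trans = ≤-trans
        }
      ; antisym = ≤-antisym
      }
    }

  module ≤-Reasoning = PosetReasoning ≤-poset

  𝟙-unique : ∀ {a} → 𝟙 ≤ a → a ≡ 𝟙
  𝟙-unique p = ≤-antisym (𝟙-greatest _) p

  𝟘-unique : ∀ {a} → a ≤ 𝟘 → a ≡ 𝟘
  𝟘-unique p = ≤-antisym p (𝟘-least _)

  curry≤ : ∀ {a b c} → a ⊙ b ≤ c → a ≤ b ⇒ c
  curry≤ {a} {b} {c} = Equivalence.from (residuation a b c)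

  uncurry≤ : ∀ {a b c} → a ≤ b ⇒ c → a ⊙ b ≤ c
  uncurry≤ {a} {b} {c} = Equivalence.to (residuation a b c)

  modus-ponens : ∀ {a b} → (a ⇒ b) ⊙ a ≤ b
  modus-ponens = uncurry≤ ≤-refl

  modus-ponens′ : ∀ {a b} → a ⊙ (a ⇒ b) ≤ b
  modus-ponens′ {a} {b} = subst (_≤ b) (⊙-comm _ _) modus-ponens

  ⊙-monoʳ : ∀ {a b c} → a ≤ b → c ⊙ a ≤ c ⊙ b
  ⊙-monoʳ {a} {b} {c} p =
    subst₂ _≤_ (⊙-comm a c) (⊙-comm b c) (uncurry≤ (≤-trans p (curry≤ ≤-refl)))

  ⇒-monoʳ : ∀ {a b c} → b ≤ c → a ⇒ b ≤ a ⇒ c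
  ⇒-monoʳ p = curry≤ (≤-trans modus-ponens p)

  ⇒-antitoneˡ : ∀ {a b c} → a ≤ b → b ⇒ c ≤ a ⇒ c
  ⇒-antitoneˡ p = curry≤ (≤-trans (⊙-monoʳ p) modus-ponens)

  ≤⇒⇒≡𝟙 : ∀ {a b} → a ≤ b → a ⇒ b ≡ 𝟙
  ≤⇒⇒≡𝟙 {a} {b} p = 𝟙-unique (curry≤ (subst (_≤ b) (sym (identityˡ a)) p))

  ⇒≡𝟙⇒≤ : ∀ {a b} → a ⇒ b ≡ 𝟙 → a ≤ b
  ⇒≡𝟙⇒≤ {a} {b} e = subst (_≤ b) (identityˡ a) (uncurry≤ (≤-reflexive (sym e)))

  𝟙⇒ : ∀ a → 𝟙 ⇒ a ≡ a
  𝟙⇒ a = ≤-antisym (subst (_≤ a) (identityʳ _) modus-ponens)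
                   (curry≤ (≤-reflexive (identityʳ a)))

  ≤⇒ : ∀ {a b} → b ≤ a ⇒ b
  ≤⇒ {a} {b} = curry≤ (≤-trans (⊙-monoʳ (𝟙-greatest a)) (≤-reflexive (identityʳ b)))

  ≤⇒⇒ : ∀ {a b} → a ≤ (a ⇒ b) ⇒ b
  ≤⇒⇒ = curry≤ modus-ponens′

  ⇒-compose : ∀ {a b c} → (a ⇒ b) ⊙ (b ⇒ c) ≤ a ⇒ c
  ⇒-compose {a} {b} {c} = curry≤ (begin
    (a ⇒ b) ⊙ (b ⇒ c) ⊙ a    ≡⟨ cong (_⊙ a) (⊙-comm (a ⇒ b) (b ⇒ c)) ⟩
    (b ⇒ c) ⊙ (a ⇒ b) ⊙ a    ≡⟨ ⊙-assoc (b ⇒ c) (a ⇒ b) a ⟩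
    (b ⇒ c) ⊙ ((a ⇒ b) ⊙ a)  ≤⟨ ⊙-monoʳ modus-ponens ⟩
    (b ⇒ c) ⊙ b              ≤⟨ modus-ponens ⟩
    c                        ∎)
    where open ≤-Reasoning

  ⊙≤∧ : ∀ a b → a ⊙ b ≤ a ∧ b
  ⊙≤∧ a b = ∧-greatest (uncurry≤ (≤⇒ {b} {a}))
                       (subst (_≤ b) (⊙-comm b a) (uncurry≤ (≤⇒ {a} {b})))

  ⇒-curry : ∀ a b c → (a ⊙ b) ⇒ c ≡ a ⇒ (b ⇒ c)
  ⇒-curry a b c = ≤-antisym
    (curry≤ (curry≤ (subst (_≤ c) (sym (⊙-assoc _ a b)) modus-ponens)))
    (curry≤ (subst (_≤ c) (⊙-assoc _ a b) (uncurry≤ (uncurry≤ ≤-refl))))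

  ⇒-exchange : ∀ a b c → a ⇒ (b ⇒ c) ≡ b ⇒ (a ⇒ c)
  ⇒-exchange a b c = begin
    a ⇒ (b ⇒ c)  ≡⟨ sym (⇒-curry a b c) ⟩
    (a ⊙ b) ⇒ c  ≡⟨ cong (_⇒ c) (⊙-comm a b) ⟩
    (b ⊙ a) ⇒ c  ≡⟨ ⇒-curry b a c ⟩
    b ⇒ (a ⇒ c)  ∎
    where open ≡-Reasoning

  ¬-antitone : ∀ {a b} → a ≤ b → ¬ b ≤ ¬ a
  ¬-antitone = ⇒-antitoneˡ

  ≤¬¬ : ∀ a → a ≤ ¬ (¬ a)
  ≤¬¬ a = ≤⇒⇒

  ¬¬-mono : ∀ {a b} → a ≤ b → ¬ (¬ a) ≤ ¬ (¬ b)
  ¬¬-mono p = ¬-antitone (¬-antitone p)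

  ¬¬¬ : ∀ a → ¬ (¬ (¬ a)) ≡ ¬ a
  ¬¬¬ a = ≤-antisym (¬-antitone (≤¬¬ a)) (≤¬¬ (¬ a))

  ¬𝟙 : ¬ 𝟙 ≡ 𝟘
  ¬𝟙 = 𝟙⇒ 𝟘

  ¬𝟘 : ¬ 𝟘 ≡ 𝟙
  ¬𝟘 = ≤⇒⇒≡𝟙 ≤-refl

  ¬-contrapose : ∀ a b → a ⇒ ¬ b ≡ b ⇒ ¬ a
  ¬-contrapose a b = ⇒-exchange a b 𝟘

  ¬⊙ : ∀ a b → ¬ (a ⊙ b) ≡ a ⇒ ¬ b
  ¬⊙ a b = ⇒-curry a b 𝟘

  ⇒¬-¬¬ : ∀ a b → a ⇒ ¬ b ≡ ¬ (¬ a) ⇒ ¬ b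
  ⇒¬-¬¬ a b = begin
    a ⇒ ¬ b          ≡⟨ ¬-contrapose a b ⟩
    b ⇒ ¬ a          ≡⟨ cong (b ⇒_) (sym (¬¬¬ a)) ⟩
    b ⇒ ¬ (¬ (¬ a))  ≡⟨ ¬-contrapose b (¬ (¬ a)) ⟩
    ¬ (¬ a) ⇒ ¬ b    ∎
    where open ≡-Reasoning

  Regular : Carrier → Set
  Regular r = ¬ (¬ r) ≡ r

  ¬-regular : ∀ a → Regular (¬ a)
  ¬-regular = ¬¬¬

  regular-¬¬≤ : ∀ {a r} → Regular r → a ≤ r → ¬ (¬ a) ≤ r
  regular-¬¬≤ {a} {r} rr p = subst (¬ (¬ a) ≤_) rr (¬¬-mono p)

  ⇒-regular : ∀ {r} a → Regular r → Regular (a ⇒ r)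
  ⇒-regular {r} a rr = begin
    ¬ (¬ (a ⇒ r))            ≡⟨ cong (λ z → ¬ (¬ (a ⇒ z))) (sym rr) ⟩
    ¬ (¬ (a ⇒ ¬ (¬ r)))      ≡⟨ cong (λ z → ¬ (¬ z)) (sym (¬⊙ a (¬ r))) ⟩
    ¬ (¬ (¬ (a ⊙ ¬ r)))      ≡⟨ ¬¬¬ (a ⊙ ¬ r) ⟩
    ¬ (a ⊙ ¬ r)              ≡⟨ ¬⊙ a (¬ r) ⟩
    a ⇒ ¬ (¬ r)              ≡⟨ cong (a ⇒_) rr ⟩
    a ⇒ r                    ∎
    where open ≡-Reasoning

  ¬¬⇒≤ : ∀ a b → ¬ (¬ (a ⇒ b)) ≤ a ⇒ ¬ (¬ b)
  ¬¬⇒≤ a b = regular-¬¬≤ (⇒-regular a (¬-regular (¬ b))) (⇒-monoʳ (≤¬¬ b))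

  dense⇒¬¬≡𝟙 : ∀ {a} → Ds a → ¬ (¬ a) ≡ 𝟙
  dense⇒¬¬≡𝟙 d = trans (cong ¬_ d) ¬𝟘

  ¬¬≡𝟙⇒dense : ∀ {a} → ¬ (¬ a) ≡ 𝟙 → Ds a
  ¬¬≡𝟙⇒dense {a} e = trans (sym (¬¬¬ a)) (trans (cong ¬_ e) ¬𝟙)

  dense-⊙ : ∀ {b} a → Ds b → ¬ (a ⊙ b) ≡ ¬ a
  dense-⊙ a d = trans (¬⊙ a _) (cong (a ⇒_) d)

  Ds-upward : ∀ {a b} → a ≤ b → Ds a → Ds b
  Ds-upward p d = 𝟘-unique (≤-trans (¬-antitone p) (≤-reflexive d))

  Ds-∧ : ∀ {a b} → Ds a → Ds b → Ds (a ∧ b)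
  Ds-∧ {a} {b} da db = Ds-upward (⊙≤∧ a b) (trans (dense-⊙ a db) da)

  dense-⇒ : ∀ {a b} → Ds (a ⇒ b) → ¬ b ≤ ¬ a
  dense-⇒ {a} {b} d = begin
    ¬ b            ≡⟨ sym (¬¬¬ b) ⟩
    ¬ (¬ (¬ b))    ≤⟨ ¬-antitone a≤¬¬b ⟩
    ¬ a            ∎
    where
    open ≤-Reasoning
    a≤¬¬b : a ≤ ¬ (¬ b)
    a≤¬¬b = ⇒≡𝟙⇒≤ (𝟙-unique (≤-trans (≤-reflexive (sym (dense⇒¬¬≡𝟙 d))) (¬¬⇒≤ a b)))

  ~⇒¬≡ : ∀ {a b} → a ~ b → ¬ a ≡ ¬ b
  ~⇒¬≡ d = ≤-antisym (dense-⇒ (Ds-upward (x∧y≤y _ _) d))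
                     (dense-⇒ (Ds-upward (x∧y≤x _ _) d))

  module Glivenko (glivenko : IsGlivenko) where

    ⇒¬¬≤ : ∀ a b → a ⇒ ¬ (¬ b) ≤ ¬ (¬ (a ⇒ b))
    ⇒¬¬≤ a b = begin
      a ⇒ ¬ (¬ b)                               ≤⟨ ≤¬¬ _ ⟩
      ¬ (¬ (a ⇒ ¬ (¬ b)))                       ≡⟨ cong ¬_ (sym (dense-⊙ _ ¬¬b⇒b-dense)) ⟩
      ¬ (¬ ((a ⇒ ¬ (¬ b)) ⊙ (¬ (¬ b) ⇒ b)))     ≤⟨ ¬¬-mono ⇒-compose ⟩
      ¬ (¬ (a ⇒ b))                             ∎
      where
      open ≤-Reasoning
      ¬¬b⇒b-dense : Ds (¬ (¬ b) ⇒ b)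
      ¬¬b⇒b-dense = ¬¬≡𝟙⇒dense (glivenko b)

    ¬¬-⇒ : ∀ a b → ¬ (¬ (a ⇒ b)) ≡ a ⇒ ¬ (¬ b)
    ¬¬-⇒ a b = ≤-antisym (¬¬⇒≤ a b) (⇒¬¬≤ a b)

    ¬¬-⇒-¬¬ : ∀ a b → ¬ (¬ (a ⇒ b)) ≡ ¬ (¬ a) ⇒ ¬ (¬ b)
    ¬¬-⇒-¬¬ a b = trans (¬¬-⇒ a b) (⇒¬-¬¬ a (¬ b))

    ¬≡⇒~ : ∀ {a b} → ¬ a ≡ ¬ b → a ~ b
    ¬≡⇒~ e = Ds-∧ (dense-implication e) (dense-implication (sym e))
      where
      dense-implication : ∀ {a b} → ¬ a ≡ ¬ b → Ds (a ⇒ b)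
      dense-implication {a} {b} e = ¬¬≡𝟙⇒dense
        (trans (¬¬-⇒ a b) (≤⇒⇒≡𝟙 (≤-trans (≤¬¬ a) (≤-reflexive (cong ¬_ e)))))

  -- Divisibility x ∧ y ~ x ⊙ (x → y) in the quotient forces the equation,
  -- since its two sides are the negations of the two products below.
  ¬-divisibility : ∀ a b → ¬ (¬ (¬ b) ⊙ (¬ (¬ b) ⇒ ¬ (¬ a))) ≡ (¬ a ⇒ ¬ b) ⇒ ¬ b
  ¬-divisibility a b = begin
    ¬ (B ⊙ (B ⇒ ¬ (¬ a)))   ≡⟨ ¬⊙ B _ ⟩
    B ⇒ ¬ (B ⇒ ¬ (¬ a))     ≡⟨ ¬-contrapose B _ ⟩
    (B ⇒ ¬ (¬ a)) ⇒ ¬ B     ≡⟨ cong (_⇒ ¬ B) (¬-contrapose B (¬ a)) ⟩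
    (¬ a ⇒ ¬ B) ⇒ ¬ B       ≡⟨ cong (λ z → (¬ a ⇒ z) ⇒ z) (¬¬¬ b) ⟩
    (¬ a ⇒ ¬ b) ⇒ ¬ b       ∎
    where
    open ≡-Reasoning
    B : Carrier
    B = ¬ (¬ b)

  divisibility⇒equation : (∀ x y → (x ∧ y) ~ (x ⊙ (x ⇒ y))) → SatisfiesEq
  divisibility⇒equation divisible a b = begin
    (¬ a ⇒ ¬ b) ⇒ ¬ b        ≡⟨ sym (¬-divisibility a b) ⟩
    ¬ (B ⊙ (B ⇒ A′))         ≡⟨ sym (~⇒¬≡ (divisible B A′)) ⟩
    ¬ (B ∧ A′)               ≡⟨ cong ¬_ (Lattice.∧-comm lattice B A′) ⟩
    ¬ (A′ ∧ B)               ≡⟨ ~⇒¬≡ (divisible A′ B) ⟩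
    ¬ (A′ ⊙ (A′ ⇒ B))        ≡⟨ ¬-divisibility b a ⟩
    (¬ b ⇒ ¬ a) ⇒ ¬ a        ∎
    where
    open ≡-Reasoning
    A′ B : Carrier
    A′ = ¬ (¬ a)
    B = ¬ (¬ b)

  module Equation (glivenko : IsGlivenko) (equation : SatisfiesEq) where
    open Glivenko glivenko

    -- For regular v, (u → v) → v is the least regular upper bound of u and v
    -- (it is an upper bound in any residuated lattice; leastness needs the
    -- symmetry given by the equation).
    regular-join-least : ∀ {u v w} → Regular v → Regular w →
                         u ≤ w → v ≤ w → (u ⇒ v) ⇒ v ≤ w
    regular-join-least {u} {v} {w} rv rw u≤w v≤w = begin
      (u ⇒ v) ⇒ v    ≤⟨ ⇒-antitoneˡ (⇒-antitoneˡ u≤w) ⟩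
      (w ⇒ v) ⇒ v    ≡⟨ subst₂ (λ w′ v′ → (w′ ⇒ v′) ⇒ v′ ≡ (v′ ⇒ w′) ⇒ w′)
                               rw rv (equation (¬ w) (¬ v)) ⟩
      (v ⇒ w) ⇒ w    ≡⟨ cong (_⇒ w) (≤⇒⇒≡𝟙 v≤w) ⟩
      𝟙 ⇒ w          ≡⟨ 𝟙⇒ w ⟩
      w              ∎
      where open ≤-Reasoning

    ¬-modus-ponens : ∀ {p y} → y ≤ ¬ (¬ p) → ¬ ((p ⇒ ¬ (¬ y)) ⊙ p) ≡ ¬ y
    ¬-modus-ponens {p} {y} y≤¬¬p = begin
      ¬ ((p ⇒ ¬ (¬ y)) ⊙ p)    ≡⟨ ¬⊙ _ p ⟩
      (p ⇒ ¬ (¬ y)) ⇒ ¬ p      ≡⟨ cong (_⇒ ¬ p) (¬-contrapose p (¬ y)) ⟩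
      (¬ y ⇒ ¬ p) ⇒ ¬ p        ≡⟨ equation y p ⟩
      (¬ p ⇒ ¬ y) ⇒ ¬ y        ≡⟨ cong (_⇒ ¬ y) (¬-contrapose (¬ p) y) ⟩
      (y ⇒ ¬ (¬ p)) ⇒ ¬ y      ≡⟨ cong (_⇒ ¬ y) (≤⇒⇒≡𝟙 y≤¬¬p) ⟩
      𝟙 ⇒ ¬ y                  ≡⟨ 𝟙⇒ (¬ y) ⟩
      ¬ y                      ∎
      where open ≡-Reasoning

    -- Prelinearity on regular elements, in the form (p → q) ≤ q for
    -- p = X → Y, q = Y → X, X = ¬¬x, Y = ¬¬y.  With ℓ = p → Y = q → X one
    -- has ℓ ⊙ p ⊙ (p → q) ≤ X, and ¬¬(ℓ ⊙ p) = Y, whence Y ⊙ (p → q) ≤ X.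
    ¬¬-prelinear : ∀ x y → let X = ¬ (¬ x); Y = ¬ (¬ y) in
                   (X ⇒ Y) ⇒ (Y ⇒ X) ≤ Y ⇒ X
    ¬¬-prelinear x y = curry≤ (subst (_≤ X) (⊙-comm Y k) (uncurry≤ Y≤k⇒X))
      where
      X Y p q k : Carrier
      X = ¬ (¬ x)
      Y = ¬ (¬ y)
      p = X ⇒ Y
      q = Y ⇒ X
      k = p ⇒ q

      ℓ⊙p⊙k≤X : (p ⇒ Y) ⊙ p ⊙ k ≤ X
      ℓ⊙p⊙k≤X = begin
        (p ⇒ Y) ⊙ p ⊙ k      ≡⟨ ⊙-assoc (p ⇒ Y) p k ⟩
        (p ⇒ Y) ⊙ (p ⊙ k)    ≤⟨ ⊙-monoʳ modus-ponens′ ⟩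
        (p ⇒ Y) ⊙ q          ≡⟨ cong (_⊙ q) (equation (¬ x) (¬ y)) ⟩
        (q ⇒ X) ⊙ q          ≤⟨ modus-ponens ⟩
        X                    ∎
        where open ≤-Reasoning

      y≤¬¬p : y ≤ ¬ (¬ p)
      y≤¬¬p = ≤-trans (≤¬¬ y) (≤-trans ≤⇒ (≤¬¬ p))

      Y≤k⇒X : Y ≤ k ⇒ X
      Y≤k⇒X = begin
        Y                        ≡⟨ cong ¬_ (sym (¬-modus-ponens y≤¬¬p)) ⟩
        ¬ (¬ ((p ⇒ Y) ⊙ p))      ≤⟨ regular-¬¬≤ (⇒-regular k (¬-regular (¬ x)))
                                                (curry≤ ℓ⊙p⊙k≤X) ⟩
        k ⇒ X                    ∎
        where open ≤-Reasoning

    -- (x → y) ∨ (y → x) is dense: its double negation lies above the regular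
    -- join of ¬¬(x → y) = X → Y and ¬¬(y → x) = Y → X, which is 1.
    prelinearity : ∀ x y → ((x ⇒ y) ∨ (y ⇒ x)) ~ 𝟙
    prelinearity x y = ¬≡⇒~ (trans (¬¬≡𝟙⇒dense ¬¬c≡𝟙) (sym ¬𝟙))
      where
      c X Y : Carrier
      c = (x ⇒ y) ∨ (y ⇒ x)
      X = ¬ (¬ x)
      Y = ¬ (¬ y)

      ¬¬c≡𝟙 : ¬ (¬ c) ≡ 𝟙
      ¬¬c≡𝟙 = 𝟙-unique (begin
        𝟙                            ≡⟨ sym (≤⇒⇒≡𝟙 (¬¬-prelinear x y)) ⟩
        ((X ⇒ Y) ⇒ (Y ⇒ X)) ⇒ (Y ⇒ X) ≤⟨ regular-join-least
              (⇒-regular Y (¬-regular (¬ x))) (¬-regular (¬ c))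
              (subst (_≤ ¬ (¬ c)) (¬¬-⇒-¬¬ x y) (¬¬-mono (x≤x∨y _ _)))
              (subst (_≤ ¬ (¬ c)) (¬¬-⇒-¬¬ y x) (¬¬-mono (y≤x∨y _ _))) ⟩
        ¬ (¬ c)                      ∎)
        where open ≤-Reasoning

    divisibility : ∀ x y → (x ∧ y) ~ (x ⊙ (x ⇒ y))
    divisibility x y = ¬≡⇒~ (≤-antisym (¬-antitone product≤meet) ¬product≤¬meet)
      where
      product≤meet : x ⊙ (x ⇒ y) ≤ x ∧ y
      product≤meet = ∧-greatest (≤-trans (⊙≤∧ x (x ⇒ y)) (x∧y≤x _ _)) modus-ponens′

      ¬product≤¬meet : ¬ (x ⊙ (x ⇒ y)) ≤ ¬ (x ∧ y)
      ¬product≤¬meet = begin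
        ¬ (x ⊙ (x ⇒ y))          ≡⟨ ¬⊙ x (x ⇒ y) ⟩
        x ⇒ ¬ (x ⇒ y)            ≡⟨ ¬-contrapose x (x ⇒ y) ⟩
        (x ⇒ y) ⇒ ¬ x            ≡⟨ ⇒¬-¬¬ (x ⇒ y) x ⟩
        ¬ (¬ (x ⇒ y)) ⇒ ¬ x      ≡⟨ cong (_⇒ ¬ x) (¬¬-⇒ x y) ⟩
        (x ⇒ ¬ (¬ y)) ⇒ ¬ x      ≡⟨ cong (_⇒ ¬ x) (¬-contrapose x (¬ y)) ⟩
        (¬ y ⇒ ¬ x) ⇒ ¬ x        ≡⟨ equation y x ⟩
        (¬ x ⇒ ¬ y) ⇒ ¬ y        ≤⟨ regular-join-least (¬-regular y) (¬-regular (x ∧ y))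
                                      (¬-antitone (x∧y≤x x y)) (¬-antitone (x∧y≤y x y)) ⟩
        ¬ (x ∧ y)                ∎
        where open ≤-Reasoning

    involution : ∀ x → (¬ (¬ x)) ~ x
    involution x = ¬≡⇒~ (¬¬¬ x)

proposition3p6 : (A : ResiduatedLattice) → ResiduatedLattice.IsGlivenko A →
    (ResiduatedLattice.QuotientIsMV A ⇔ ResiduatedLattice.SatisfiesEq A)
proposition3p6 A glivenko = mk⇔
  (λ (_ , divisible , _) → divisibility⇒equation divisible)
  (λ equation → let open Equation glivenko equation in
                prelinearity , divisibility , involution)
  where open ResiduatedLatticeTheory A
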